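{- Let $P=\{p_1,\dots,p_d\}$ and $Q=\{q_1,\dots,q_d\}$ be disjoint finite posets with $|P|=|Q|=d\ge1$. (1) If $P\cong Q\cong\mathbf C_d$, then $N(\Gamma(P,Q))=2^d<14\cdot 6^{(d-3)/2}$. (2) If $P\cong Q\cong \mathbf I_d$, then $N(\Gamma(P,Q))=d^2+d$; if $d=2$ then $d^2+d=6$, and if $d\ne2$ then $d^2+d<14\cdot 6^{(d-3)/2}$. (3) If $P\cong\mathbf I_d$ and $Q\cong \mathbf C_d$, then $N(\Gamma(P,Q))=d\cdot 2^{d-1}+1<14\cdot 6^{(d-3)/2}$.
   Context: For a finite poset $P=\{p_1,\dots,p_d\}$, an antichain is a set of pairwise incomparable elements (including $\emptyset$); for an antichain $A$ put $\rho(A)=\sum_{p_i\in A}\mathbf e_i\in\mathbb R^d$. The chain polytope is $\mathcal C(P)=\mathrm{conv}\{\rho(A): A\text{ antichain}\}$. For $Q=\{q_1,\dots,q_d\}$, $\Gamma(P,Q)=\mathrm{conv}(\mathcal C(P)\cup(-\mathcal C(Q)))\subset\mathbb R^d$ (coordinate $i$ corresponds to $p_i$ and $q_i$). $N(\mathcal P)$ is the number of facets of $\mathcal P$. $\mathbf C_d$ is the $d$-element chain and $\mathbf I_d$ the $d$-element antichain. -}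

module Defs where

open import Data.Nat as ℕ using (ℕ; zero; suc; _*_; _^_)
open import Data.Bool using (Bool; true; false; if_then_else_)
open import Data.Fin as Fin using (Fin; zero; suc)
open import Data.Fin.Subset using (Subset; _∈_)
open import Data.Vec using (lookup)
open import Data.Product using (Σ; _×_)
open import Data.Rational as ℚ using (ℚ; 0ℚ; 1ℚ; -_)
open import Relation.Binary.PropositionalEquality using (_≡_)
open import Function.Bundles using (_↔_; _⇔_; Inverse)

-- A relation on Fin d (the poset P = {p_1,…,p_d}, element p_i ↦ i).
Rel : ℕ → Set₁
Rel d = Fin d → Fin d → Set

OrderIso : ∀ {d} → Rel d → Rel d → Set
OrderIso {d} R S = Σ (Fin d ↔ Fin d) λ f →
  ∀ x y → R x y ⇔ S (Inverse.to f x) (Inverse.to f y)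

chainRel : ∀ {d} → Rel d
chainRel x y = x Fin.≤ y

antichainRel : ∀ {d} → Rel d
antichainRel x y = x ≡ y

IsAntichain : ∀ {d} → Rel d → Subset d → Set
IsAntichain R A = ∀ i j → i ∈ A → j ∈ A → R i j → i ≡ j

sumℚ : ∀ {n} → (Fin n → ℚ) → ℚ
sumℚ {zero} f = 0ℚ
sumℚ {suc n} f = f zero ℚ.+ sumℚ (λ i → f (suc i))

dot : ∀ {d} → (Fin d → ℚ) → (Fin d → ℚ) → ℚ
dot a x = sumℚ (λ i → a i ℚ.* x i)

ρ : ∀ {d} → Subset d → (Fin d → ℚ)
ρ A i = if lookup A i then 1ℚ else 0ℚ

-- Generators of Γ(P,Q): (true , A) ↦ ρ(A) (A antichain of P),
-- (false , B) ↦ -ρ(B) (B antichain of Q).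
Gen : ℕ → Set
Gen d = Bool × Subset d

Valid : ∀ {d} → Rel d → Rel d → Gen d → Set
Valid P Q (true  Data.Product., A) = IsAntichain P A
Valid P Q (false Data.Product., A) = IsAntichain Q A

pt : ∀ {d} → Gen d → (Fin d → ℚ)
pt (true  Data.Product., A) = ρ A
pt (false Data.Product., A) = λ i → - ρ A i

-- A face of Γ(P,Q) = conv{pt g | Valid g}, recorded by the set of generators
-- lying on it: the equality set of a valid linear inequality a·x ≤ b.
GSet : ℕ → Set
GSet d = Gen d → Bool

IsFace : ∀ {d} → Rel d → Rel d → GSet d → Set
IsFace {d} P Q S = Σ (Fin d → ℚ) λ a → Σ ℚ λ b →
  (∀ g → Valid P Q g → dot a (pt g) ℚ.≤ b) ×
  (∀ g → (S g ≡ true) ⇔ (Valid P Q g × dot a (pt g) ≡ b))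

IsProper : ∀ {d} → Rel d → Rel d → GSet d → Set
IsProper P Q S = Σ _ λ g → Valid P Q g × S g ≡ false

_⊆G_ : ∀ {d} → GSet d → GSet d → Set
S ⊆G T = ∀ g → S g ≡ true → T g ≡ true

IsFacet : ∀ {d} → Rel d → Rel d → GSet d → Set
IsFacet P Q S = IsFace P Q S × IsProper P Q S ×
  (∀ T → IsFace P Q T → IsProper P Q T → S ⊆G T → T ⊆G S)

-- N(Γ(P,Q)) = n : the facets are enumerated without repetition by Fin n.
NumFacets : ∀ {d} → Rel d → Rel d → ℕ → Set
NumFacets {d} P Q n = Σ (Fin n → GSet d) λ F →
  (∀ k → IsFacet P Q (F k)) ×
  (∀ k l → (∀ g → F k g ≡ F l g) → k ≡ l) ×
  (∀ S → IsFacet P Q S → Σ (Fin n) λ k → ∀ g → S g ≡ F k g)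

-- x < 14 · 6^{(d-3)/2}  ⇔  x² < 196 · 6^{d-3}  ⇔  216 · x² < 196 · 6^d  (x ≥ 0)
BelowBound : ℕ → ℕ → Set
BelowBound x d = 216 * (x * x) ℕ.< 196 * 6 ^ d

-- Each candidate vector c gives the face of Γ(P,Q) on the hyperplane c·x = 1. It is a facet,
-- because a valid inequality a·x ≤ b that is tight on this face is forced to be a = b·c, already
-- by its values at ∅, at the singletons ±e_k and, on an antichain side, at the pairs {i,k}.
-- Conversely a facet a·x ≤ b has b > 0, and its tight generators lie on the hyperplane of some
-- candidate: a set A maximizing a·ρ(A) contains every coordinate where a is positive and none
-- where a is negative, and the antichains of a chain are ∅ and the singletons. The candidates are
-- {±1}^d for two chains; e_i − e_j, e_i and −e_j for two antichains; and, for an antichain P and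
-- a chain Q, e_i minus the indicator of a set of other coordinates, and (−1,…,−1). Distinct
-- candidates give distinct facets, hence 2^d, d² + d and d·2^(d−1) + 1 facets. Each count grows
-- by a factor at most 12/5 < √6 per step once d is not too small, which gives the bound
-- 14·6^((d−3)/2) by induction on d.

module Submission where

open import Defs
open import Data.Nat using (ℕ; _≤_; _+_; _*_; _^_; _∸_)
open import Data.Fin using (Fin)
open import Data.Product using (_×_)
open import Relation.Binary.PropositionalEquality using (_≡_)
open import Relation.Binary.Structures using (IsPartialOrder)
open import Relation.Nullary using (¬_)

open import Algebra.Bundles using (CommutativeMonoid)
open import Data.Bool using (Bool; true; false; if_then_else_)
import Data.Bool.Properties as Bool
open import Data.Empty using (⊥-elim)
open import Data.Fin as Fin using (zero; suc)
import Data.Fin.Properties as Fin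
open import Data.Fin.Subset using (Subset; _∈_; _∉_; ⁅_⁆; inside; outside) renaming (⊥ to ∅)
import Data.Fin.Subset.Properties as Subset
import Data.Nat as ℕ
import Data.Nat.Properties as ℕ
open import Data.Nat.Solver using (module +-*-Solver)
open import Data.Product using (Σ; _,_; proj₁; proj₂)
open import Data.Product.Function.NonDependent.Propositional using (_×-↔_)
open import Data.Rational as ℚ using (ℚ; 0ℚ; 1ℚ; -_)
import Data.Rational.Properties as ℚ
open import Data.Sum using (_⊎_; inj₁; inj₂)
open import Data.Sum.Function.Propositional using (_⊎-↔_)
open import Data.Unit using (⊤; tt)
open import Data.Vec using (Vec; []; _∷_; lookup; tabulate; insertAt; removeAt; _[_]≔_; here; there)
import Data.Vec.Properties as Vec
open import Function.Bundles using (_⇔_; mk⇔; Equivalence; _↔_; mk↔ₛ′; Inverse)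
open import Function.Properties.Inverse using (↔-refl; ↔-trans)
open import Relation.Binary.Definitions using (tri<; tri≈; tri>)
open import Relation.Binary.PropositionalEquality
  using (refl; sym; trans; cong; cong₂; subst; subst₂; _≢_; ≢-sym; module ≡-Reasoning)
open import Relation.Nullary using (Dec; yes; no; does)
open import Relation.Nullary.Decidable using (map′; _×-dec_; _⊎-dec_; dec-true; dec-false)

open import Algebra.Properties.Group ℚ.+-0-group
  using (identityˡ-unique) renaming (⁻¹-involutive to neg-involutive)
open import Algebra.Properties.CommutativeSemigroup (CommutativeMonoid.commutativeSemigroup ℚ.+-0-commutativeMonoid)
  using (x∙yz≈y∙xz)

1≢0 : 1ℚ ≢ 0ℚ
1≢0 ()

1≢-1 : 1ℚ ≢ - 1ℚ
1≢-1 ()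

-1≢0 : - 1ℚ ≢ 0ℚ
-1≢0 ()

-1≤0 : - 1ℚ ℚ.≤ 0ℚ
-1≤0 = ℚ.≤ᵇ⇒≤ tt

0≤1 : 0ℚ ℚ.≤ 1ℚ
0≤1 = ℚ.≤ᵇ⇒≤ tt

-1≤1 : - 1ℚ ℚ.≤ 1ℚ
-1≤1 = ℚ.≤ᵇ⇒≤ tt

<⇒≱ : ∀ {p q} → p ℚ.< q → ¬ q ℚ.≤ p
<⇒≱ p<q q≤p = ℚ.<-irrefl refl (ℚ.<-≤-trans p<q q≤p)

-pos≢pos : ∀ {b} → 0ℚ ℚ.< b → - b ≢ b
-pos≢pos 0<b = ℚ.<⇒≢ (ℚ.<-trans (ℚ.neg-antimono-< 0<b) 0<b)

neg-≤0⇒0≤ : ∀ {x} → - x ℚ.≤ 0ℚ → 0ℚ ℚ.≤ x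
neg-≤0⇒0≤ {x} -x≤0 = subst (0ℚ ℚ.≤_) (neg-involutive x) (ℚ.neg-antimono-≤ -x≤0)

-x≡y⇒x≡-y : ∀ {x y} → - x ≡ y → x ≡ - y
-x≡y⇒x≡-y {x} e = trans (sym (neg-involutive x)) (cong -_ e)

*-cancelˡ-pos : ∀ {b x y} → 0ℚ ℚ.< b → b ℚ.* x ≡ b ℚ.* y → x ≡ y
*-cancelˡ-pos {b} 0<b e =
  ℚ.≤-antisym (ℚ.*-cancelˡ-≤-pos b (ℚ.≤-reflexive e)) (ℚ.*-cancelˡ-≤-pos b (ℚ.≤-reflexive (sym e)))
  where
  instance
    b-positive : ℚ.Positive b
    b-positive = ℚ.positive 0<b

scaled-1 : ∀ {a b c} → a ≡ b → c ≡ 1ℚ → a ≡ b ℚ.* c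
scaled-1 {b = b} refl refl = sym (ℚ.*-identityʳ b)

scaled-−1 : ∀ {a b c} → - a ≡ b → c ≡ - 1ℚ → a ≡ b ℚ.* c
scaled-−1 {a} refl refl = begin
  a                  ≡⟨ sym (neg-involutive a) ⟩
  - (- a)            ≡⟨ cong -_ (sym (ℚ.*-identityʳ (- a))) ⟩
  - (- a ℚ.* 1ℚ)     ≡⟨ ℚ.neg-distribʳ-* (- a) 1ℚ ⟩
  - a ℚ.* - 1ℚ       ∎
  where open ≡-Reasoning

scaled-0 : ∀ {a b c} → a ≡ 0ℚ → c ≡ 0ℚ → a ≡ b ℚ.* c
scaled-0 {b = b} refl refl = sym (ℚ.*-zeroʳ b)

neg : ∀ {d} → (Fin d → ℚ) → Fin d → ℚ
neg c k = - c k

bit : Bool → ℚ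
bit b = if b then 1ℚ else 0ℚ

sumℚ-cong : ∀ {d} {f g : Fin d → ℚ} → (∀ k → f k ≡ g k) → sumℚ f ≡ sumℚ g
sumℚ-cong {ℕ.zero} e = refl
sumℚ-cong {ℕ.suc d} e = cong₂ ℚ._+_ (e zero) (sumℚ-cong (λ k → e (suc k)))

sumℚ-*ˡ : ∀ {d} b (f : Fin d → ℚ) → sumℚ (λ k → b ℚ.* f k) ≡ b ℚ.* sumℚ f
sumℚ-*ˡ {ℕ.zero} b f = sym (ℚ.*-zeroʳ b)
sumℚ-*ˡ {ℕ.suc d} b f = trans (cong (b ℚ.* f zero ℚ.+_) (sumℚ-*ˡ b (λ k → f (suc k))))
                              (sym (ℚ.*-distribˡ-+ b (f zero) _))

dot-congˡ : ∀ {d} {c c' : Fin d → ℚ} (x : Fin d → ℚ) → (∀ k → c k ≡ c' k) → dot c x ≡ dot c' x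
dot-congˡ x e = sumℚ-cong (λ k → cong (ℚ._* x k) (e k))

dot-*ˡ : ∀ {d} b (c x : Fin d → ℚ) → dot (λ k → b ℚ.* c k) x ≡ b ℚ.* dot c x
dot-*ˡ b c x = trans (sumℚ-cong (λ k → ℚ.*-assoc b (c k) (x k))) (sumℚ-*ˡ b (λ k → c k ℚ.* x k))

dot-zeroˡ : ∀ {d} {c : Fin d → ℚ} (x : Fin d → ℚ) → (∀ k → c k ≡ 0ℚ) → dot c x ≡ 0ℚ
dot-zeroˡ {ℕ.zero} x z = refl
dot-zeroˡ {ℕ.suc d} x z =
  cong₂ ℚ._+_ (trans (cong (ℚ._* x zero) (z zero)) (ℚ.*-zeroˡ (x zero)))
              (dot-zeroˡ (λ k → x (suc k)) (λ k → z (suc k)))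

dot-negʳ : ∀ {d} (c x : Fin d → ℚ) → dot c (neg x) ≡ dot (neg c) x
dot-negʳ c x = sumℚ-cong λ k → trans (sym (ℚ.neg-distribʳ-* (c k) (x k))) (ℚ.neg-distribˡ-* (c k) (x k))

dot-neg-neg : ∀ {d} (c x : Fin d → ℚ) → dot (neg (neg c)) x ≡ dot c x
dot-neg-neg c x = dot-congˡ x (λ k → neg-involutive (c k))

true≢false : true ≢ false
true≢false ()

∈⇒[]≔inside : ∀ {d} {A : Subset d} {k} → k ∈ A → A [ k ]≔ inside ≡ A
∈⇒[]≔inside {A = A} {k} k∈A = subst (λ b → A [ k ]≔ b ≡ A) (Vec.[]=⇒lookup k∈A) (Vec.[]≔-lookup A k)

∉⇒lookup≡outside : ∀ {d} {A : Subset d} {k} → k ∉ A → lookup A k ≡ outside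
∉⇒lookup≡outside {A = A} {k} k∉A with lookup A k in e
... | true = ⊥-elim (k∉A (Vec.lookup⇒[]= k A e))
... | false = refl

∉⇒[]≔outside : ∀ {d} {A : Subset d} {k} → k ∉ A → A [ k ]≔ outside ≡ A
∉⇒[]≔outside {A = A} {k} k∉A =
  subst (λ b → A [ k ]≔ b ≡ A) (∉⇒lookup≡outside k∉A) (Vec.[]≔-lookup A k)

insertAt-removeAt-∉ : ∀ {n} {W : Subset (ℕ.suc n)} {i} → i ∉ W → insertAt (removeAt W i) i outside ≡ W
insertAt-removeAt-∉ {W = W} {i} i∉W =
  trans (cong (insertAt (removeAt W i) i) (sym (∉⇒lookup≡outside i∉W))) (Vec.insertAt-removeAt W i)

∈-[]≔-≢ : ∀ {d} {A : Subset d} {k m} x → m ≢ k → m ∈ A [ k ]≔ x → m ∈ A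
∈-[]≔-≢ {A = A} {k} {m} x m≢k m∈ =
  Vec.lookup⇒[]= m A (trans (sym (Vec.lookup∘update′ m≢k A x)) (Vec.[]=⇒lookup m∈))

∈-[]≔outside : ∀ {d} {A : Subset d} {i k} → k ∈ A [ i ]≔ outside → k ∈ A × k ≢ i
∈-[]≔outside {A = A} {i} k∈ = ∈-[]≔-≢ outside k≢i k∈ , k≢i
  where
  k≢i : _ ≢ i
  k≢i refl = true≢false (Vec.[]=-injective k∈ (Vec.[]≔-updates A i))

does⇔ : ∀ {A : Set} (a? : Dec A) → (does a? ≡ true) ⇔ A
does⇔ (yes a) = mk⇔ (λ _ → a) (λ _ → refl)
does⇔ (no ¬a) = mk⇔ (λ ()) (λ a → ⊥-elim (¬a a))

∈-tabulate⇔ : ∀ {d} {P : Fin d → Set} (P? : ∀ k → Dec (P k)) k → k ∈ tabulate (λ k → does (P? k)) ⇔ P k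
∈-tabulate⇔ P? k = mk⇔
  (λ k∈ → Equivalence.to (does⇔ (P? k)) (trans (sym lookup-k) (Vec.[]=⇒lookup k∈)))
  (λ Pk → Vec.lookup⇒[]= k _ (trans lookup-k (Equivalence.from (does⇔ (P? k)) Pk)))
  where
  lookup-k : lookup (tabulate (λ k → does (P? k))) k ≡ does (P? k)
  lookup-k = Vec.lookup∘tabulate (λ k → does (P? k)) k

lookup-ext : ∀ {A : Set} {m} (u v : Vec A m) → (∀ k → lookup u k ≡ lookup v k) → u ≡ v
lookup-ext u v e = trans (sym (Vec.tabulate∘lookup u)) (trans (Vec.tabulate-cong e) (Vec.tabulate∘lookup v))

dot-ρ-[]≔ : ∀ {d} (c : Fin d → ℚ) (A : Subset d) k →
  dot c (ρ (A [ k ]≔ inside)) ≡ c k ℚ.+ dot c (ρ (A [ k ]≔ outside))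
dot-ρ-[]≔ c (_ ∷ A) zero =
  cong₂ ℚ._+_ (ℚ.*-identityʳ (c zero))
    (sym (trans (cong (ℚ._+ rest) (ℚ.*-zeroʳ (c zero))) (ℚ.+-identityˡ rest)))
  where
  rest : ℚ
  rest = dot (λ i → c (suc i)) (ρ A)
dot-ρ-[]≔ c (s ∷ A) (suc k) =
  trans (cong (c zero ℚ.* bit s ℚ.+_) (dot-ρ-[]≔ (λ i → c (suc i)) A k))
        (x∙yz≈y∙xz (c zero ℚ.* bit s) (c (suc k)) (dot (λ i → c (suc i)) (ρ (A [ k ]≔ outside))))

dot-ρ-split : ∀ {d} (c : Fin d → ℚ) {A : Subset d} {i} → i ∈ A →
  dot c (ρ A) ≡ c i ℚ.+ dot c (ρ (A [ i ]≔ outside))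
dot-ρ-split c {A} {i} i∈A =
  subst (λ B → dot c (ρ B) ≡ c i ℚ.+ dot c (ρ (A [ i ]≔ outside))) (∈⇒[]≔inside i∈A) (dot-ρ-[]≔ c A i)

dot-ρ-insert : ∀ {d} (c : Fin d → ℚ) {A : Subset d} {k} → k ∉ A →
  dot c (ρ (A [ k ]≔ inside)) ≡ c k ℚ.+ dot c (ρ A)
dot-ρ-insert c {A} {k} k∉A =
  trans (dot-ρ-[]≔ c A k) (cong (λ B → c k ℚ.+ dot c (ρ B)) (∉⇒[]≔outside k∉A))

dot-ρ-insert-cancel : ∀ {d} (c : Fin d → ℚ) {A : Subset d} {k} → k ∉ A →
  dot c (ρ (A [ k ]≔ inside)) ≡ dot c (ρ A) → c k ≡ 0ℚ
dot-ρ-insert-cancel c k∉A e = identityˡ-unique _ _ (trans (sym (dot-ρ-insert c k∉A)) e)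

dot-ρ-vanish : ∀ {d} {c : Fin d → ℚ} {A : Subset d} → (∀ k → k ∈ A → c k ≡ 0ℚ) → dot c (ρ A) ≡ 0ℚ
dot-ρ-vanish {A = []} z = refl
dot-ρ-vanish {c = c} {inside ∷ A} z =
  cong₂ ℚ._+_ (trans (ℚ.*-identityʳ (c zero)) (z zero here)) (dot-ρ-vanish (λ k k∈A → z (suc k) (there k∈A)))
dot-ρ-vanish {c = c} {outside ∷ A} z =
  cong₂ ℚ._+_ (ℚ.*-zeroʳ (c zero)) (dot-ρ-vanish (λ k k∈A → z (suc k) (there k∈A)))

dot-ρ-nonpos : ∀ {d} {c : Fin d → ℚ} {A : Subset d} →
  (∀ k → k ∈ A → c k ℚ.≤ 0ℚ) → dot c (ρ A) ℚ.≤ 0ℚ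
dot-ρ-nonpos {A = []} h = ℚ.≤-refl
dot-ρ-nonpos {c = c} {inside ∷ A} h =
  ℚ.+-mono-≤ (ℚ.≤-trans (ℚ.≤-reflexive (ℚ.*-identityʳ (c zero))) (h zero here))
             (dot-ρ-nonpos (λ k k∈A → h (suc k) (there k∈A)))
dot-ρ-nonpos {c = c} {outside ∷ A} h =
  ℚ.+-mono-≤ (ℚ.≤-reflexive (ℚ.*-zeroʳ (c zero))) (dot-ρ-nonpos (λ k k∈A → h (suc k) (there k∈A)))

dot-ρ-nonpos-≢ : ∀ {d} {c : Fin d → ℚ} {A : Subset d} {b} →
  0ℚ ℚ.< b → (∀ k → c k ℚ.≤ 0ℚ) → dot c (ρ A) ≢ b
dot-ρ-nonpos-≢ {c = c} {A} 0<b c≤0 tight =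
  <⇒≱ 0<b (subst (ℚ._≤ 0ℚ) tight (dot-ρ-nonpos {c = c} {A} (λ k _ → c≤0 k)))

dot-ρ-∈ : ∀ {d} (c : Fin d → ℚ) {A : Subset d} {i} → i ∈ A →
  (∀ k → k ∈ A → k ≢ i → c k ≡ 0ℚ) → dot c (ρ A) ≡ c i
dot-ρ-∈ c {A} {i} i∈A h = begin
  dot c (ρ A)                          ≡⟨ dot-ρ-split c i∈A ⟩
  c i ℚ.+ dot c (ρ (A [ i ]≔ outside)) ≡⟨ cong (c i ℚ.+_) (dot-ρ-vanish vanishes) ⟩
  c i ℚ.+ 0ℚ                           ≡⟨ ℚ.+-identityʳ (c i) ⟩
  c i                                  ∎
  where
  open ≡-Reasoning
  vanishes : ∀ k → k ∈ A [ i ]≔ outside → c k ≡ 0ℚ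
  vanishes k k∈ = h k (proj₁ (∈-[]≔outside k∈)) (proj₂ (∈-[]≔outside k∈))

dot-ρ-⁅⁆ : ∀ {d} (c : Fin d → ℚ) i → dot c (ρ ⁅ i ⁆) ≡ c i
dot-ρ-⁅⁆ c i = dot-ρ-∈ c (Subset.x∈⁅x⁆ i) λ k k∈ k≢i → ⊥-elim (k≢i (Subset.x∈⁅y⁆⇒x≡y i k∈))

dot-ρ-∅ : ∀ {d} (c : Fin d → ℚ) → dot c (ρ ∅) ≡ 0ℚ
dot-ρ-∅ c = dot-ρ-vanish {c = c} (λ k k∈∅ → ⊥-elim (Subset.∉⊥ k∈∅))

dot-pt-false-⁅⁆ : ∀ {d} (c : Fin d → ℚ) k → dot c (pt (false , ⁅ k ⁆)) ≡ - c k
dot-pt-false-⁅⁆ c k = trans (dot-negʳ c (ρ ⁅ k ⁆)) (dot-ρ-⁅⁆ (neg c) k)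

dot-ρ-≤ : ∀ {d} (c : Fin d → ℚ) {A : Subset d} {i q} →
  (∀ k → k ∈ A → k ≢ i → c k ℚ.≤ 0ℚ) → c i ℚ.≤ q → 0ℚ ℚ.≤ q → dot c (ρ A) ℚ.≤ q
dot-ρ-≤ c {A} {i} {q} h ci≤q 0≤q with i Subset.∈? A
... | yes i∈A = begin
  dot c (ρ A)                          ≡⟨ dot-ρ-split c i∈A ⟩
  c i ℚ.+ dot c (ρ (A [ i ]≔ outside)) ≤⟨ ℚ.+-mono-≤ ci≤q (dot-ρ-nonpos rest≤0) ⟩
  q ℚ.+ 0ℚ                             ≡⟨ ℚ.+-identityʳ q ⟩
  q                                    ∎
  where
  open ℚ.≤-Reasoning
  rest≤0 : ∀ k → k ∈ A [ i ]≔ outside → c k ℚ.≤ 0ℚ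
  rest≤0 k k∈ = h k (proj₁ (∈-[]≔outside k∈)) (proj₂ (∈-[]≔outside k∈))
... | no i∉A = ℚ.≤-trans (dot-ρ-nonpos λ k k∈A → h k k∈A (λ { refl → i∉A k∈A })) 0≤q

Maximizes : ∀ {d} → (Fin d → ℚ) → Subset d → Set
Maximizes c A = ∀ B → dot c (ρ B) ℚ.≤ dot c (ρ A)

maximizer-∋-positive : ∀ {d} {c : Fin d → ℚ} {A k} → Maximizes c A → 0ℚ ℚ.< c k → k ∈ A
maximizer-∋-positive {c = c} {A} {k} max 0<ck with k Subset.∈? A
... | yes k∈A = k∈A
... | no k∉A = ⊥-elim (<⇒≱ larger (max (A [ k ]≔ inside)))
  where
  larger : dot c (ρ A) ℚ.< dot c (ρ (A [ k ]≔ inside))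
  larger = subst₂ ℚ._<_ (ℚ.+-identityˡ (dot c (ρ A))) (sym (dot-ρ-insert c k∉A))
                  (ℚ.+-monoˡ-< (dot c (ρ A)) 0<ck)

maximizer-∌-negative : ∀ {d} {c : Fin d → ℚ} {A k} → Maximizes c A → c k ℚ.< 0ℚ → k ∉ A
maximizer-∌-negative {c = c} {A} {k} max ck<0 k∈A = <⇒≱ larger (max (A [ k ]≔ outside))
  where
  rest : ℚ
  rest = dot c (ρ (A [ k ]≔ outside))
  larger : dot c (ρ A) ℚ.< rest
  larger = subst₂ ℚ._<_ (sym (dot-ρ-split c k∈A)) (ℚ.+-identityˡ rest) (ℚ.+-monoˡ-< rest ck<0)

_[_↦_] : ∀ {d} → (Fin d → ℚ) → Fin d → ℚ → Fin d → ℚ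
(c [ i ↦ v ]) k = if does (k Fin.≟ i) then v else c k

[↦]-same : ∀ {d} (c : Fin d → ℚ) i v → (c [ i ↦ v ]) i ≡ v
[↦]-same c i v = cong (λ b → if b then v else c i) (dec-true (i Fin.≟ i) refl)

[↦]-other : ∀ {d} (c : Fin d → ℚ) {i k} v → k ≢ i → (c [ i ↦ v ]) k ≡ c k
[↦]-other c {i} {k} v k≢i = cong (λ b → if b then v else c k) (dec-false (k Fin.≟ i) k≢i)

bit-injective : ∀ {s t} → bit s ≡ bit t → s ≡ t
bit-injective {true} {true} _ = refl
bit-injective {false} {false} _ = refl
bit-injective {true} {false} ()
bit-injective {false} {true} ()

-ρ-∈ : ∀ {d} {W : Subset d} {k} → k ∈ W → neg (ρ W) k ≡ - 1ℚ
-ρ-∈ k∈W = cong (λ b → - bit b) (Vec.[]=⇒lookup k∈W)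

-ρ-∉ : ∀ {d} {W : Subset d} {k} → k ∉ W → neg (ρ W) k ≡ 0ℚ
-ρ-∉ k∉W = cong (λ b → - bit b) (∉⇒lookup≡outside k∉W)

-ρ-≤0 : ∀ {d} (W : Subset d) k → neg (ρ W) k ℚ.≤ 0ℚ
-ρ-≤0 W k with lookup W k
... | true = -1≤0
... | false = ℚ.≤-refl

-ρ-≢1 : ∀ {d} (W : Subset d) k → neg (ρ W) k ≢ 1ℚ
-ρ-≢1 W k with lookup W k
... | true = λ ()
... | false = λ ()

-ρ-≡-1 : ∀ {d} {W : Subset d} {k} → neg (ρ W) k ≡ - 1ℚ → k ∈ W
-ρ-≡-1 {W = W} {k} e with lookup W k in eW
... | true = Vec.lookup⇒[]= k W eW
... | false = ⊥-elim (-1≢0 (sym e))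

spike : ∀ {d} → Fin d → Subset d → Fin d → ℚ
spike i W = neg (ρ W) [ i ↦ 1ℚ ]

module _ {d} (i : Fin d) (W : Subset d) where

  spike-at : spike i W i ≡ 1ℚ
  spike-at = [↦]-same (neg (ρ W)) i 1ℚ

  spike-∈ : ∀ {k} → k ≢ i → k ∈ W → spike i W k ≡ - 1ℚ
  spike-∈ k≢i k∈W = trans ([↦]-other (neg (ρ W)) 1ℚ k≢i) (-ρ-∈ k∈W)

  spike-∉ : ∀ {k} → k ≢ i → k ∉ W → spike i W k ≡ 0ℚ
  spike-∉ k≢i k∉W = trans ([↦]-other (neg (ρ W)) 1ℚ k≢i) (-ρ-∉ k∉W)

  spike-≤0 : ∀ {k} → k ≢ i → spike i W k ℚ.≤ 0ℚ
  spike-≤0 {k} k≢i = subst (ℚ._≤ 0ℚ) (sym ([↦]-other (neg (ρ W)) 1ℚ k≢i)) (-ρ-≤0 W k)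

  spike-≡1 : ∀ {k} → spike i W k ≡ 1ℚ → k ≡ i
  spike-≡1 {k} e with k Fin.≟ i
  ... | yes k≡i = k≡i
  ... | no k≢i = ⊥-elim (-ρ-≢1 W k e)

  spike-≡-1 : ∀ {k} → k ≢ i → spike i W k ≡ - 1ℚ → k ∈ W
  spike-≡-1 k≢i e = -ρ-≡-1 (trans (sym ([↦]-other (neg (ρ W)) 1ℚ k≢i)) e)

  -spike-≤1 : ∀ k → - spike i W k ℚ.≤ 1ℚ
  -spike-≤1 k with k Fin.≟ i
  ... | yes _ = -1≤1
  ... | no _ with lookup W k
  ...   | true  = ℚ.≤-refl
  ...   | false = 0≤1

  -spike-≤0 : ∀ {k} → k ∉ W → - spike i W k ℚ.≤ 0ℚ
  -spike-≤0 {k} k∉W with k Fin.≟ i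
  ... | yes _ = -1≤0
  ... | no _ = ℚ.≤-reflexive (cong -_ (-ρ-∉ k∉W))

  spike-bounded : ∀ A → dot (spike i W) (ρ A) ℚ.≤ 1ℚ
  spike-bounded A = dot-ρ-≤ (spike i W) {A} (λ k _ k≢i → spike-≤0 k≢i) (ℚ.≤-reflexive spike-at) 0≤1

  spike-tight : ∀ {A} → i ∈ A → (∀ k → k ∈ A → k ≢ i → k ∉ W) → dot (spike i W) (ρ A) ≡ 1ℚ
  spike-tight i∈A avoids =
    trans (dot-ρ-∈ (spike i W) i∈A λ k k∈A k≢i → spike-∉ k≢i (avoids k k∈A k≢i)) spike-at

  spike-determines : ∀ {a b} → (∀ A → dot (spike i W) (ρ A) ≡ 1ℚ → dot a (ρ A) ≡ b) →
    a i ≡ b × (∀ k → k ≢ i → k ∉ W → a k ≡ 0ℚ)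
  spike-determines {a} {b} tight = a-at-i , a-off
    where
    i∈⁅i⁆ : i ∈ ⁅ i ⁆
    i∈⁅i⁆ = Subset.x∈⁅x⁆ i
    tight-⁅i⁆ : dot a (ρ ⁅ i ⁆) ≡ b
    tight-⁅i⁆ = tight ⁅ i ⁆ (spike-tight i∈⁅i⁆ λ k k∈ k≢i →
      ⊥-elim (k≢i (Subset.x∈⁅y⁆⇒x≡y i k∈)))
    a-at-i : a i ≡ b
    a-at-i = trans (sym (dot-ρ-⁅⁆ a i)) tight-⁅i⁆
    a-off : ∀ k → k ≢ i → k ∉ W → a k ≡ 0ℚ
    a-off k k≢i k∉W = dot-ρ-insert-cancel a k∉⁅i⁆
      (trans (tight (⁅ i ⁆ [ k ]≔ inside) (spike-tight i∈pair only-k)) (sym tight-⁅i⁆))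
      where
      k∉⁅i⁆ : k ∉ ⁅ i ⁆
      k∉⁅i⁆ = Subset.x≢y⇒x∉⁅y⁆ k≢i
      i∈pair : i ∈ ⁅ i ⁆ [ k ]≔ inside
      i∈pair = Vec.[]≔-minimal ⁅ i ⁆ i k (λ i≡k → k≢i (sym i≡k)) i∈⁅i⁆
      only-k : ∀ m → m ∈ ⁅ i ⁆ [ k ]≔ inside → m ≢ i → m ∉ W
      only-k m m∈ m≢i with m Fin.≟ k
      ... | yes refl = k∉W
      ... | no m≢k = ⊥-elim (m≢i (Subset.x∈⁅y⁆⇒x≡y i (∈-[]≔-≢ {A = ⁅ i ⁆} inside m≢k m∈)))

-spike-⁅⁆-bounded : ∀ {d} (i j : Fin d) B → dot (neg (spike i ⁅ j ⁆)) (ρ B) ℚ.≤ 1ℚ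
-spike-⁅⁆-bounded i j B = dot-ρ-≤ (neg (spike i ⁅ j ⁆)) {B} off-j (-spike-≤1 i ⁅ j ⁆ j) 0≤1
  where
  off-j : ∀ k → k ∈ B → k ≢ j → - spike i ⁅ j ⁆ k ℚ.≤ 0ℚ
  off-j k _ k≢j = -spike-≤0 i ⁅ j ⁆ (Subset.x≢y⇒x∉⁅y⁆ k≢j)

-spike-⁅⁆-tight : ∀ {d} {i j : Fin d} {B} → j ∈ B → i ∉ B → dot (neg (spike i ⁅ j ⁆)) (ρ B) ≡ 1ℚ
-spike-⁅⁆-tight {i = i} {j} {B} j∈B i∉B = trans (dot-ρ-∈ (neg (spike i ⁅ j ⁆)) j∈B off-j)
  (cong -_ (spike-∈ i ⁅ j ⁆ (λ j≡i → i∉B (subst (_∈ B) j≡i j∈B)) (Subset.x∈⁅x⁆ j)))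
  where
  off-j : ∀ k → k ∈ B → k ≢ j → - spike i ⁅ j ⁆ k ≡ 0ℚ
  off-j k k∈B k≢j =
    cong -_ (spike-∉ i ⁅ j ⁆ (λ k≡i → i∉B (subst (_∈ B) k≡i k∈B)) (Subset.x≢y⇒x∉⁅y⁆ k≢j))

spike-⁅⁆-injective : ∀ {d} {i j j' : Fin d} → (∀ k → spike i ⁅ j ⁆ k ≡ spike i ⁅ j' ⁆ k) → j ≡ j'
spike-⁅⁆-injective {i = i} {j} {j'} e with j Fin.≟ i | j' Fin.≟ i
... | yes j≡i | yes j'≡i = trans j≡i (sym j'≡i)
... | no j≢i | _ = Subset.x∈⁅y⁆⇒x≡y j'
  (spike-≡-1 i ⁅ j' ⁆ j≢i (trans (sym (e j)) (spike-∈ i ⁅ j ⁆ j≢i (Subset.x∈⁅x⁆ j))))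
... | _ | no j'≢i = sym (Subset.x∈⁅y⁆⇒x≡y j
  (spike-≡-1 i ⁅ j ⁆ j'≢i (trans (e j') (spike-∈ i ⁅ j' ⁆ j'≢i (Subset.x∈⁅x⁆ j')))))

spike-≗⇒lookup : ∀ {d} (i : Fin d) W W' {k} → k ≢ i → spike i W k ≡ spike i W' k → lookup W k ≡ lookup W' k
spike-≗⇒lookup i W W' k≢i e = bit-injective (ℚ.neg-injective
  (trans (sym ([↦]-other (neg (ρ W)) 1ℚ k≢i)) (trans e ([↦]-other (neg (ρ W')) 1ℚ k≢i))))

sign : Bool → ℚ
sign true = 1ℚ
sign false = - 1ℚ

sign-≤1 : ∀ s → sign s ℚ.≤ 1ℚ
sign-≤1 true = ℚ.≤-refl
sign-≤1 false = -1≤1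

-sign-≤1 : ∀ s → - sign s ℚ.≤ 1ℚ
-sign-≤1 true = -1≤1
-sign-≤1 false = ℚ.≤-refl

sign-injective : ∀ {s t} → sign s ≡ sign t → s ≡ t
sign-injective {true} {true} _ = refl
sign-injective {false} {false} _ = refl
sign-injective {true} {false} ()
sign-injective {false} {true} ()

-- Antichains of chains and of antichains

∅-isAntichain : ∀ {d} (R : Rel d) → IsAntichain R ∅
∅-isAntichain R i j i∈∅ = ⊥-elim (Subset.∉⊥ i∈∅)

⁅⁆-isAntichain : ∀ {d} (R : Rel d) k → IsAntichain R ⁅ k ⁆
⁅⁆-isAntichain R k i j i∈ j∈ _ = trans (Subset.x∈⁅y⁆⇒x≡y k i∈) (sym (Subset.x∈⁅y⁆⇒x≡y k j∈))

antichainRel-isAntichain : ∀ {d} {R : Rel d} → OrderIso R antichainRel → ∀ A → IsAntichain R A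
antichainRel-isAntichain (f , iso) A i j _ _ Rij =
  trans (sym (Inverse.strictlyInverseʳ f i))
        (trans (cong (Inverse.from f) (Equivalence.to (iso i j) Rij)) (Inverse.strictlyInverseʳ f j))

EmptyOrSingleton : ∀ {d} → Subset d → Set
EmptyOrSingleton A = A ≡ ∅ ⊎ Σ _ λ k → A ≡ ⁅ k ⁆

emptyOrSingleton? : ∀ {d} (A : Subset d) → Dec (EmptyOrSingleton A)
emptyOrSingleton? A = Vec.≡-dec Bool._≟_ A ∅ ⊎-dec Fin.any? (λ k → Vec.≡-dec Bool._≟_ A ⁅ k ⁆)

emptyOrSingleton-isAntichain : ∀ {d} (R : Rel d) {A} → EmptyOrSingleton A → IsAntichain R A
emptyOrSingleton-isAntichain R (inj₁ refl) = ∅-isAntichain R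
emptyOrSingleton-isAntichain R (inj₂ (k , refl)) = ⁅⁆-isAntichain R k

chainRel-antichain-emptyOrSingleton : ∀ {d} {R : Rel d} → OrderIso R chainRel →
  ∀ {A} → IsAntichain R A → EmptyOrSingleton A
chainRel-antichain-emptyOrSingleton {R = R} (f , iso) {A} anti with Subset.nonempty? A
... | no empty = inj₁ (Subset.Empty-unique empty)
... | yes (k , k∈A) = inj₂ (k , Subset.⊆-antisym
  (λ j∈A → subst (_∈ ⁅ k ⁆) (sym (≡k j∈A)) (Subset.x∈⁅x⁆ k))
  (λ j∈⁅k⁆ → subst (_∈ A) (sym (Subset.x∈⁅y⁆⇒x≡y k j∈⁅k⁆)) k∈A))
  where
  comparable : ∀ i j → R i j ⊎ R j i
  comparable i j with Fin.≤-total (Inverse.to f i) (Inverse.to f j)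
  ... | inj₁ fi≤fj = inj₁ (Equivalence.from (iso i j) fi≤fj)
  ... | inj₂ fj≤fi = inj₂ (Equivalence.from (iso j i) fj≤fi)
  ≡k : ∀ {j} → j ∈ A → j ≡ k
  ≡k {j} j∈A with comparable j k
  ... | inj₁ Rjk = anti j k j∈A k∈A Rjk
  ... | inj₂ Rkj = sym (anti k j k∈A j∈A Rkj)

chainRel-antichain? : ∀ {d} {R : Rel d} → OrderIso R chainRel → ∀ A → Dec (IsAntichain R A)
chainRel-antichain? {R = R} iso A =
  map′ (emptyOrSingleton-isAntichain R) (chainRel-antichain-emptyOrSingleton iso) (emptyOrSingleton? A)

chainRel-dot-bounded : ∀ {d} {R : Rel d} → OrderIso R chainRel → ∀ {c A} →
  (∀ k → c k ℚ.≤ 1ℚ) → IsAntichain R A → dot c (ρ A) ℚ.≤ 1ℚ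
chainRel-dot-bounded iso {c} c≤1 anti with chainRel-antichain-emptyOrSingleton iso anti
... | inj₁ refl = subst (ℚ._≤ 1ℚ) (sym (dot-ρ-∅ c)) 0≤1
... | inj₂ (k , refl) = subst (ℚ._≤ 1ℚ) (sym (dot-ρ-⁅⁆ c k)) (c≤1 k)

chainRel-dot-tight : ∀ {d} {R : Rel d} → OrderIso R chainRel → ∀ {a b A} →
  IsAntichain R A → 0ℚ ℚ.< b → dot a (ρ A) ≡ b → Σ (Fin d) λ k → A ≡ ⁅ k ⁆ × a k ≡ b
chainRel-dot-tight iso {a} anti 0<b tight with chainRel-antichain-emptyOrSingleton iso anti
... | inj₁ refl = ⊥-elim (ℚ.<⇒≢ 0<b (trans (sym (dot-ρ-∅ a)) tight))
... | inj₂ (k , refl) = k , refl , trans (sym (dot-ρ-⁅⁆ a k)) tight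

-- Facets of Γ(P,Q)

module Facets {d} (P Q : Rel d) (valid? : ∀ g → Dec (Valid P Q g)) where

  ValidIneq : (Fin d → ℚ) → ℚ → Set
  ValidIneq a b = ∀ g → Valid P Q g → dot a (pt g) ℚ.≤ b

  EqualitySet : (Fin d → ℚ) → ℚ → GSet d → Set
  EqualitySet a b S = ∀ g → (S g ≡ true) ⇔ (Valid P Q g × dot a (pt g) ≡ b)

  offset-pos : ∀ {a b S} → ValidIneq a b → EqualitySet a b S → IsProper P Q S → 0ℚ ℚ.< b
  offset-pos {a} {b} {S} ineq eqs (g , valid , g∉S) with ℚ.<-cmp 0ℚ b
  ... | tri< 0<b _ _ = 0<b
  ... | tri> _ _ b<0 = ⊥-elim (<⇒≱ b<0 (subst (ℚ._≤ b) (dot-ρ-∅ a) (ineq (true , ∅) (∅-isAntichain P))))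
  ... | tri≈ _ refl _ =
    ⊥-elim (true≢false (trans (sym (Equivalence.from (eqs g) (valid , dot-zeroˡ {c = a} (pt g) a≡0))) g∉S))
    where
    a≡0 : ∀ k → a k ≡ 0ℚ
    a≡0 k = ℚ.≤-antisym (subst (ℚ._≤ 0ℚ) (dot-ρ-⁅⁆ a k) (ineq (true , ⁅ k ⁆) (⁅⁆-isAntichain P k)))
      (neg-≤0⇒0≤ (subst (ℚ._≤ 0ℚ) (dot-pt-false-⁅⁆ a k) (ineq (false , ⁅ k ⁆) (⁅⁆-isAntichain Q k))))

  Tight : (Fin d → ℚ) → GSet d
  Tight c g = does (valid? g ×-dec (dot c (pt g) ℚ.≟ 1ℚ))

  Tight⇔ : ∀ c → EqualitySet c 1ℚ (Tight c)
  Tight⇔ c g = does⇔ (valid? g ×-dec (dot c (pt g) ℚ.≟ 1ℚ))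

  Bounded : (Fin d → ℚ) → Set
  Bounded c = ValidIneq c 1ℚ

  TightImplies : (Fin d → ℚ) → ℚ → (Fin d → ℚ) → ℚ → Set
  TightImplies a b c e = ∀ g → Valid P Q g → dot a (pt g) ≡ b → dot c (pt g) ≡ e

  Determines : (Fin d → ℚ) → Set
  Determines c = ∀ a b → TightImplies c 1ℚ a b → ∀ k → a k ≡ b ℚ.* c k

  tight-true-⁅⁆ : ∀ c a {b} → TightImplies c 1ℚ a b → ∀ k → c k ≡ 1ℚ → a k ≡ b
  tight-true-⁅⁆ c a tight k ck≡1 = trans (sym (dot-ρ-⁅⁆ a k))
    (tight (true , ⁅ k ⁆) (⁅⁆-isAntichain P k) (trans (dot-ρ-⁅⁆ c k) ck≡1))

  tight-false-⁅⁆ : ∀ c a {b} → TightImplies c 1ℚ a b → ∀ k → - c k ≡ 1ℚ → - a k ≡ b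
  tight-false-⁅⁆ c a tight k -ck≡1 = trans (sym (dot-pt-false-⁅⁆ a k))
    (tight (false , ⁅ k ⁆) (⁅⁆-isAntichain Q k) (trans (dot-pt-false-⁅⁆ c k) -ck≡1))

  Tight-isProper : ∀ c → IsProper P Q (Tight c)
  Tight-isProper c = (true , ∅) , ∅-isAntichain P ,
    dec-false (valid? (true , ∅) ×-dec (dot c (ρ ∅) ℚ.≟ 1ℚ)) λ (_ , e) → 1≢0 (trans (sym e) (dot-ρ-∅ c))

  Tight-isFacet : ∀ {c} → Bounded c → Determines c → IsFacet P Q (Tight c)
  Tight-isFacet {c} bounded determines = (c , 1ℚ , bounded , Tight⇔ c) , Tight-isProper c , maximal
    where
    maximal : ∀ T → IsFace P Q T → IsProper P Q T → Tight c ⊆G T → T ⊆G Tight c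
    maximal T (a , b , ineq , eqs) proper c⊆T g g∈T = Equivalence.from (Tight⇔ c g) (valid , tight)
      where
      a≡bc : ∀ k → a k ≡ b ℚ.* c k
      a≡bc = determines a b λ g v e →
        proj₂ (Equivalence.to (eqs g) (c⊆T g (Equivalence.from (Tight⇔ c g) (v , e))))
      valid : Valid P Q g
      valid = proj₁ (Equivalence.to (eqs g) g∈T)
      tight : dot c (pt g) ≡ 1ℚ
      tight = *-cancelˡ-pos (offset-pos {a} {b} {T} ineq eqs proper) (begin
        b ℚ.* dot c (pt g)               ≡⟨ sym (dot-*ˡ b c (pt g)) ⟩
        dot (λ k → b ℚ.* c k) (pt g)     ≡⟨ sym (dot-congˡ (pt g) a≡bc) ⟩
        dot a (pt g)                     ≡⟨ proj₂ (Equivalence.to (eqs g) g∈T) ⟩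
        b                                ≡⟨ sym (ℚ.*-identityʳ b) ⟩
        b ℚ.* 1ℚ                         ∎)
        where open ≡-Reasoning

  Covers : ∀ {I : Set} → (I → Fin d → ℚ) → Set
  Covers {I} c = ∀ a b → 0ℚ ℚ.< b → ValidIneq a b → Σ I λ x → TightImplies a b (c x) 1ℚ

  facet-≡-Tight : ∀ {S c} → IsFacet P Q S → Bounded c → S ⊆G Tight c → ∀ g → S g ≡ Tight c g
  facet-≡-Tight {S} {c} (_ , _ , maximal) bounded S⊆c g with S g in eS | Tight c g in ec
  ... | true  | true  = refl
  ... | false | false = refl
  ... | true  | false = trans (sym (S⊆c g eS)) ec
  ... | false | true  = trans (sym eS) (maximal (Tight c) (c , 1ℚ , bounded , Tight⇔ c) (Tight-isProper c) S⊆c g ec)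

  numFacets : ∀ {n} {I : Set} (enum : Fin n ↔ I) (c : I → Fin d → ℚ) →
    (∀ x → Bounded (c x)) → (∀ x → Determines (c x)) →
    (∀ x y → (∀ k → c x k ≡ c y k) → x ≡ y) → Covers c → NumFacets P Q n
  numFacets {n} enum c bounded determines c-injective covers =
    (λ i → Tight (c (to i))) , (λ i → Tight-isFacet (bounded (to i)) (determines (to i))) , injective , cover
    where
    open Inverse enum
    Tight-injective : ∀ x y → (∀ g → Tight (c x) g ≡ Tight (c y) g) → x ≡ y
    Tight-injective x y e = c-injective x y λ k →
      trans (sym (ℚ.*-identityˡ (c x k))) (sym (determines x (c y) 1ℚ y-tight k))
      where
      y-tight : TightImplies (c x) 1ℚ (c y) 1ℚ
      y-tight g v t = proj₂ (Equivalence.to (Tight⇔ (c y) g)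
        (trans (sym (e g)) (Equivalence.from (Tight⇔ (c x) g) (v , t))))
    injective : ∀ i j → (∀ g → Tight (c (to i)) g ≡ Tight (c (to j)) g) → i ≡ j
    injective i j e = trans (sym (strictlyInverseʳ i)) (trans (cong from (Tight-injective _ _ e)) (strictlyInverseʳ j))
    cover : ∀ S → IsFacet P Q S → Σ (Fin n) λ i → ∀ g → S g ≡ Tight (c (to i)) g
    cover S S-facet@((a , b , ineq , eqs) , proper , _) with covers a b (offset-pos {a} {b} {S} ineq eqs proper) ineq
    ... | x , covered = from x , λ g →
      trans (facet-≡-Tight {S} {c x} S-facet (bounded x) S⊆x g) (cong (λ y → Tight (c y) g) (sym (strictlyInverseˡ x)))
      where
      S⊆x : S ⊆G Tight (c x)
      S⊆x g g∈S = Equivalence.from (Tight⇔ (c x) g) (valid , covered g valid tight)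
        where
        valid : Valid P Q g
        valid = proj₁ (Equivalence.to (eqs g) g∈S)
        tight : dot a (pt g) ≡ b
        tight = proj₂ (Equivalence.to (eqs g) g∈S)

Fin2^↔Vec : ∀ m → Fin (2 ^ m) ↔ Vec Bool m
Fin2^↔Vec ℕ.zero = mk↔ₛ′ (λ _ → []) (λ _ → zero) (λ { [] → refl }) (λ { zero → refl ; (suc ()) })
Fin2^↔Vec (ℕ.suc m) = ↔-trans Fin.*↔× (↔-trans (Fin.2↔Bool ×-↔ Fin2^↔Vec m) ×↔∷)
  where
  ×↔∷ : (Bool × Vec Bool m) ↔ Vec Bool (ℕ.suc m)
  ×↔∷ = mk↔ₛ′ (λ (b , v) → b ∷ v) (λ { (b ∷ v) → b , v })
    (λ { (b ∷ v) → refl }) (λ { (b , v) → refl })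

-- The facets in the three cases

module ChainChain {d} {P Q : Rel d} (isoP : OrderIso P chainRel) (isoQ : OrderIso Q chainRel) where

  valid? : ∀ g → Dec (Valid P Q g)
  valid? (true , A) = chainRel-antichain? isoP A
  valid? (false , B) = chainRel-antichain? isoQ B

  open Facets P Q valid?

  signs : Vec Bool d → Fin d → ℚ
  signs σ k = sign (lookup σ k)

  bounded : ∀ σ → Bounded (signs σ)
  bounded σ (true , A) anti = chainRel-dot-bounded isoP (λ k → sign-≤1 (lookup σ k)) anti
  bounded σ (false , B) anti = subst (ℚ._≤ 1ℚ) (sym (dot-negʳ (signs σ) (ρ B)))
    (chainRel-dot-bounded isoQ (λ k → -sign-≤1 (lookup σ k)) anti)

  determines : ∀ σ → Determines (signs σ)
  determines σ a b tight k = by-sign (lookup σ k) refl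
    where
    by-sign : ∀ s → lookup σ k ≡ s → a k ≡ b ℚ.* sign (lookup σ k)
    by-sign true e = scaled-1 (tight-true-⁅⁆ (signs σ) a tight k (cong sign e)) (cong sign e)
    by-sign false e = scaled-−1 (tight-false-⁅⁆ (signs σ) a tight k (cong (λ s → - sign s) e)) (cong sign e)

  injective : ∀ σ τ → (∀ k → signs σ k ≡ signs τ k) → σ ≡ τ
  injective σ τ e = lookup-ext σ τ (λ k → sign-injective (e k))

  covers : Covers signs
  covers a b 0<b _ = σ , covered
    where
    σ : Vec Bool d
    σ = tabulate (λ k → does (a k ℚ.≟ b))
    σ-lookup : ∀ k → lookup σ k ≡ does (a k ℚ.≟ b)
    σ-lookup = Vec.lookup∘tabulate (λ k → does (a k ℚ.≟ b))
    covered : TightImplies a b (signs σ) 1ℚ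
    covered (true , A) anti tight with chainRel-dot-tight isoP anti 0<b tight
    ... | k , refl , ak≡b =
      trans (dot-ρ-⁅⁆ (signs σ) k) (cong sign (trans (σ-lookup k) (dec-true (a k ℚ.≟ b) ak≡b)))
    covered (false , B) anti tight
      with chainRel-dot-tight isoQ {neg a} anti 0<b (trans (sym (dot-negʳ a (ρ B))) tight)
    ... | k , refl , -ak≡b = trans (dot-pt-false-⁅⁆ (signs σ) k)
      (cong (λ s → - sign s) (trans (σ-lookup k) (dec-false (a k ℚ.≟ b) ak≢b)))
      where
      ak≢b : a k ≢ b
      ak≢b ak≡b = -pos≢pos 0<b (trans (cong -_ (sym ak≡b)) -ak≡b)

  numFacets-2^d : NumFacets P Q (2 ^ d)
  numFacets-2^d = numFacets (Fin2^↔Vec d) signs bounded determines injective covers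

module AntichainAntichain {n} {P Q : Rel (ℕ.suc n)}
  (isoP : OrderIso P antichainRel) (isoQ : OrderIso Q antichainRel) where

  d : ℕ
  d = ℕ.suc n

  valid : ∀ g → Valid P Q g
  valid (true , A) = antichainRel-isAntichain isoP A
  valid (false , B) = antichainRel-isAntichain isoQ B

  open Facets P Q (λ g → yes (valid g))

  Index : Set
  Index = (Fin d × Fin d) ⊎ Fin d

  -- spike i ⁅ j ⁆ is e_i − e_j, or e_i when j = i; neg (spike j ∅) is −e_j.
  coeff : Index → Fin d → ℚ
  coeff (inj₁ (i , j)) = spike i ⁅ j ⁆
  coeff (inj₂ j) = neg (spike j ∅)

  -spike-∅-off : ∀ {j k : Fin d} → k ≢ j → - spike j ∅ k ≡ 0ℚ
  -spike-∅-off {j} k≢j = cong -_ (spike-∉ j ∅ k≢j Subset.∉⊥)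

  -spike-∅-≢1 : ∀ {j k : Fin d} → - spike j ∅ k ≢ 1ℚ
  -spike-∅-≢1 {j} {k} e with j Fin.≟ k
  ... | yes refl = 1≢-1 (trans (sym e) (cong -_ (spike-at j ∅)))
  ... | no j≢k = Subset.∉⊥ (spike-≡-1 j ∅ (≢-sym j≢k) (-x≡y⇒x≡-y e))

  dot-pt-false-−spike : ∀ (j : Fin d) B → dot (neg (spike j ∅)) (pt (false , B)) ≡ dot (spike j ∅) (ρ B)
  dot-pt-false-−spike j B = trans (dot-negʳ (neg (spike j ∅)) (ρ B)) (dot-neg-neg (spike j ∅) (ρ B))

  bounded : ∀ x → Bounded (coeff x)
  bounded (inj₁ (i , j)) (true , A) _ = spike-bounded i ⁅ j ⁆ A
  bounded (inj₁ (i , j)) (false , B) _ =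
    subst (ℚ._≤ 1ℚ) (sym (dot-negʳ (spike i ⁅ j ⁆) (ρ B))) (-spike-⁅⁆-bounded i j B)
  bounded (inj₂ j) (true , A) _ = dot-ρ-≤ (neg (spike j ∅)) {A} (λ k _ k≢j → ℚ.≤-reflexive (-spike-∅-off k≢j))
    (subst (λ v → - v ℚ.≤ 1ℚ) (sym (spike-at j ∅)) -1≤1) 0≤1
  bounded (inj₂ j) (false , B) _ = subst (ℚ._≤ 1ℚ) (sym (dot-pt-false-−spike j B)) (spike-bounded j ∅ B)

  -- Deciding i ≟ k rather than k ≟ i keeps `with` from unfolding the spike in the goal.
  determines : ∀ x → Determines (coeff x)
  determines (inj₁ (i , j)) a b tight k
    with spike-determines i ⁅ j ⁆ {a} {b} (λ A → tight (true , A) (valid (true , A)))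
  ... | a-at-i , a-off with i Fin.≟ k
  ...   | yes refl = scaled-1 a-at-i (spike-at i ⁅ j ⁆)
  ...   | no i≢k with j Fin.≟ k
  ...     | yes refl = scaled-−1 (tight-false-⁅⁆ (spike i ⁅ k ⁆) a tight k (cong -_ -1-at-k)) -1-at-k
    where
    -1-at-k : spike i ⁅ k ⁆ k ≡ - 1ℚ
    -1-at-k = spike-∈ i ⁅ k ⁆ (≢-sym i≢k) (Subset.x∈⁅x⁆ k)
  ...     | no j≢k = scaled-0 {b = b} (a-off k (≢-sym i≢k) k∉⁅j⁆) (spike-∉ i ⁅ j ⁆ (≢-sym i≢k) k∉⁅j⁆)
    where
    k∉⁅j⁆ : k ∉ ⁅ j ⁆
    k∉⁅j⁆ = Subset.x≢y⇒x∉⁅y⁆ (≢-sym j≢k)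
  determines (inj₂ j) a b tight k with spike-determines j ∅ {neg a} {b} tight-Q
    where
    tight-Q : ∀ B → dot (spike j ∅) (ρ B) ≡ 1ℚ → dot (neg a) (ρ B) ≡ b
    tight-Q B t = trans (sym (dot-negʳ a (ρ B)))
      (tight (false , B) (valid (false , B)) (trans (dot-pt-false-−spike j B) t))
  ... | -a-at-j , -a-off with j Fin.≟ k
  ...   | yes refl = scaled-−1 -a-at-j (cong -_ (spike-at j ∅))
  ...   | no j≢k = scaled-0 {b = b} (-x≡y⇒x≡-y (-a-off k (≢-sym j≢k) Subset.∉⊥)) (-spike-∅-off (≢-sym j≢k))

  injective : ∀ x y → (∀ k → coeff x k ≡ coeff y k) → x ≡ y
  injective (inj₁ (i , j)) (inj₁ (i' , j')) e with spike-≡1 i' ⁅ j' ⁆ (trans (sym (e i)) (spike-at i ⁅ j ⁆))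
  ... | refl = cong (λ j → inj₁ (i , j)) (spike-⁅⁆-injective e)
  injective (inj₁ (i , j)) (inj₂ j') e = ⊥-elim (-spike-∅-≢1 {j'} {i} (trans (sym (e i)) (spike-at i ⁅ j ⁆)))
  injective (inj₂ j) (inj₁ (i' , j')) e = ⊥-elim (-spike-∅-≢1 {j} {i'} (trans (e i') (spike-at i' ⁅ j' ⁆)))
  injective (inj₂ j) (inj₂ j') e =
    cong inj₂ (spike-≡1 j' ∅ (ℚ.neg-injective (trans (sym (e j)) (cong -_ (spike-at j ∅)))))

  covers : Covers coeff
  covers a b 0<b ineq = choose (Fin.any? (λ i → 0ℚ ℚ.<? a i)) (Fin.any? (λ j → a j ℚ.<? 0ℚ))
    where
    maxP : ∀ A → dot a (ρ A) ≡ b → Maximizes a A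
    maxP A tight A' = subst (dot a (ρ A') ℚ.≤_) (sym tight) (ineq (true , A') (valid (true , A')))
    maxQ : ∀ B → dot a (pt (false , B)) ≡ b → Maximizes (neg a) B
    maxQ B tight B' = subst₂ ℚ._≤_ (dot-negʳ a (ρ B')) (trans (sym tight) (dot-negʳ a (ρ B)))
      (ineq (false , B') (valid (false , B')))
    nonpos-P : ¬ (Σ _ λ i → 0ℚ ℚ.< a i) → ∀ A → dot a (ρ A) ≢ b
    nonpos-P no-pos A = dot-ρ-nonpos-≢ {c = a} {A} 0<b (λ k → ℚ.≮⇒≥ (λ 0<ak → no-pos (k , 0<ak)))
    nonneg-Q : ¬ (Σ _ λ j → a j ℚ.< 0ℚ) → ∀ B → dot a (pt (false , B)) ≢ b
    nonneg-Q no-neg B tight = dot-ρ-nonpos-≢ {c = neg a} {B} 0<b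
      (λ k → ℚ.neg-antimono-≤ (ℚ.≮⇒≥ (λ ak<0 → no-neg (k , ak<0)))) (trans (sym (dot-negʳ a (ρ B))) tight)
    choose : Dec (Σ _ λ i → 0ℚ ℚ.< a i) → Dec (Σ _ λ j → a j ℚ.< 0ℚ) →
      Σ Index λ x → TightImplies a b (coeff x) 1ℚ
    choose (yes (i , 0<ai)) (yes (j , aj<0)) = inj₁ (i , j) , λ where
      (true , A) _ tight → spike-tight i ⁅ j ⁆ (maximizer-∋-positive {c = a} {A} (maxP A tight) 0<ai)
        λ k k∈A _ k∈⁅j⁆ → maximizer-∌-negative {c = a} {A} (maxP A tight) aj<0
          (subst (_∈ A) (Subset.x∈⁅y⁆⇒x≡y j k∈⁅j⁆) k∈A)
      (false , B) _ tight → trans (dot-negʳ (spike i ⁅ j ⁆) (ρ B)) (-spike-⁅⁆-tight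
        (maximizer-∋-positive {c = neg a} {B} (maxQ B tight) (ℚ.neg-antimono-< aj<0))
        (maximizer-∌-negative {c = neg a} {B} (maxQ B tight) (ℚ.neg-antimono-< 0<ai)))
    choose (yes (i , 0<ai)) (no no-neg) = inj₁ (i , i) , λ where
      (true , A) _ tight → spike-tight i ⁅ i ⁆ (maximizer-∋-positive {c = a} {A} (maxP A tight) 0<ai)
        λ k _ k≢i → Subset.x≢y⇒x∉⁅y⁆ k≢i
      (false , B) _ tight → ⊥-elim (nonneg-Q no-neg B tight)
    choose (no no-pos) (yes (j , aj<0)) = inj₂ j , λ where
      (true , A) _ tight → ⊥-elim (nonpos-P no-pos A tight)
      (false , B) _ tight → trans (dot-pt-false-−spike j B)
        (spike-tight j ∅ (maximizer-∋-positive {c = neg a} {B} (maxQ B tight) (ℚ.neg-antimono-< aj<0))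
          λ _ _ _ → Subset.∉⊥)
    choose (no no-pos) (no no-neg) = inj₂ zero , λ where
      (true , A) _ tight → ⊥-elim (nonpos-P no-pos A tight)
      (false , B) _ tight → ⊥-elim (nonneg-Q no-neg B tight)

  enum : Fin (d * d + d) ↔ Index
  enum = ↔-trans (Fin.+↔⊎ {d * d} {d}) (Fin.*↔× {d} {d} ⊎-↔ ↔-refl)

  numFacets-d²+d : NumFacets P Q (d * d + d)
  numFacets-d²+d = numFacets enum coeff bounded determines injective covers

module AntichainChain {n} {P Q : Rel (ℕ.suc n)} (isoP : OrderIso P antichainRel) (isoQ : OrderIso Q chainRel) where

  d : ℕ
  d = ℕ.suc n

  valid? : ∀ g → Dec (Valid P Q g)
  valid? (true , A) = yes (antichainRel-isAntichain isoP A)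
  valid? (false , B) = chainRel-antichain? isoQ B

  open Facets P Q valid?

  Index : Set
  Index = (Fin d × Vec Bool n) ⊎ ⊤

  -- U lists which of the d − 1 coordinates other than i carry −1.
  hole : Fin d → Vec Bool n → Subset d
  hole i U = insertAt U i outside

  coeff : Index → Fin d → ℚ
  coeff (inj₁ (i , U)) = spike i (hole i U)
  coeff (inj₂ _) _ = - 1ℚ

  bounded : ∀ x → Bounded (coeff x)
  bounded (inj₁ (i , U)) (true , A) _ = spike-bounded i (hole i U) A
  bounded (inj₁ (i , U)) (false , B) anti = subst (ℚ._≤ 1ℚ) (sym (dot-negʳ (coeff (inj₁ (i , U))) (ρ B)))
    (chainRel-dot-bounded isoQ (-spike-≤1 i (hole i U)) anti)
  bounded (inj₂ _) (true , A) _ = ℚ.≤-trans (dot-ρ-nonpos {c = coeff (inj₂ tt)} {A} (λ _ _ → -1≤0)) 0≤1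
  bounded (inj₂ _) (false , B) anti = subst (ℚ._≤ 1ℚ) (sym (dot-negʳ (coeff (inj₂ tt)) (ρ B)))
    (chainRel-dot-bounded isoQ (λ _ → ℚ.≤-refl) anti)

  determines : ∀ x → Determines (coeff x)
  determines (inj₁ (i , U)) a b tight k
    with spike-determines i (hole i U) {a} {b} (λ A → tight (true , A) (antichainRel-isAntichain isoP A))
  ... | a-at-i , a-off with i Fin.≟ k
  ...   | yes refl = scaled-1 a-at-i (spike-at i (hole i U))
  ...   | no i≢k with k Subset.∈? hole i U
  ...     | yes k∈W = scaled-−1 (tight-false-⁅⁆ (spike i (hole i U)) a tight k (cong -_ -1-at-k)) -1-at-k
    where
    -1-at-k : spike i (hole i U) k ≡ - 1ℚ
    -1-at-k = spike-∈ i (hole i U) (≢-sym i≢k) k∈W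
  ...     | no k∉W = scaled-0 {b = b} (a-off k (≢-sym i≢k) k∉W) (spike-∉ i (hole i U) (≢-sym i≢k) k∉W)
  determines (inj₂ _) a b tight k = scaled-−1 (tight-false-⁅⁆ (coeff (inj₂ tt)) a tight k refl) refl

  injective : ∀ x y → (∀ k → coeff x k ≡ coeff y k) → x ≡ y
  injective (inj₁ (i , U)) (inj₁ (i' , U')) e with spike-≡1 i' (hole i' U') (trans (sym (e i)) (spike-at i (hole i U)))
  ... | refl = cong (λ U → inj₁ (i , U)) (begin
    U                         ≡⟨ sym (Vec.removeAt-insertAt U i outside) ⟩
    removeAt (hole i U) i     ≡⟨ cong (λ W → removeAt W i) (lookup-ext (hole i U) (hole i U') same-lookup) ⟩
    removeAt (hole i U') i    ≡⟨ Vec.removeAt-insertAt U' i outside ⟩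
    U'                        ∎)
    where
    open ≡-Reasoning
    same-lookup : ∀ k → lookup (hole i U) k ≡ lookup (hole i U') k
    same-lookup k with i Fin.≟ k
    ... | yes refl = trans (Vec.insertAt-lookup U i outside) (sym (Vec.insertAt-lookup U' i outside))
    ... | no i≢k = spike-≗⇒lookup i (hole i U) (hole i U') (≢-sym i≢k) (e k)
  injective (inj₁ (i , U)) (inj₂ _) e = ⊥-elim (1≢-1 (trans (sym (spike-at i (hole i U))) (e i)))
  injective (inj₂ _) (inj₁ (i , U)) e = ⊥-elim (1≢-1 (trans (sym (spike-at i (hole i U))) (sym (e i))))
  injective (inj₂ _) (inj₂ _) _ = refl

  covers : Covers coeff
  covers a b 0<b ineq = choose (Fin.any? (λ i → 0ℚ ℚ.<? a i))
    where
    W : Subset d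
    W = tabulate (λ k → does (a k ℚ.<? 0ℚ))
    ∈W⇔ : ∀ k → k ∈ W ⇔ a k ℚ.< 0ℚ
    ∈W⇔ = ∈-tabulate⇔ (λ k → a k ℚ.<? 0ℚ)
    tight-Q : ∀ {B} → IsAntichain Q B → dot a (pt (false , B)) ≡ b →
      Σ (Fin d) λ k → B ≡ ⁅ k ⁆ × a k ℚ.< 0ℚ
    tight-Q {B} anti tight =
      let k , B≡⁅k⁆ , -ak≡b = chainRel-dot-tight isoQ {neg a} anti 0<b (trans (sym (dot-negʳ a (ρ B))) tight)
      in k , B≡⁅k⁆ , subst (ℚ._< 0ℚ) (neg-involutive (a k))
                           (ℚ.neg-antimono-< (subst (0ℚ ℚ.<_) (sym -ak≡b) 0<b))
    choose : Dec (Σ _ λ i → 0ℚ ℚ.< a i) → Σ Index λ x → TightImplies a b (coeff x) 1ℚ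
    choose (yes (i , 0<ai)) =
      inj₁ (i , removeAt W i) , subst (λ V → TightImplies a b (spike i V) 1ℚ) (sym hole≡W) covered
      where
      hole≡W : hole i (removeAt W i) ≡ W
      hole≡W = insertAt-removeAt-∉ {W = W} {i} (λ i∈W → ℚ.<-asym 0<ai (Equivalence.to (∈W⇔ i) i∈W))
      covered : TightImplies a b (spike i W) 1ℚ
      covered (true , A) _ tight = spike-tight i W (maximizer-∋-positive {c = a} {A} maxA 0<ai)
        (λ k k∈A _ k∈W → maximizer-∌-negative {c = a} {A} maxA (Equivalence.to (∈W⇔ k) k∈W) k∈A)
        where
        maxA : Maximizes a A
        maxA A' = subst (dot a (ρ A') ℚ.≤_) (sym tight) (ineq (true , A') (antichainRel-isAntichain isoP A'))
      covered (false , B) anti tight = singleton (tight-Q anti tight)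
        where
        singleton : ∀ {B} → Σ (Fin d) (λ k → B ≡ ⁅ k ⁆ × a k ℚ.< 0ℚ) →
          dot (spike i W) (pt (false , B)) ≡ 1ℚ
        singleton (k , refl , ak<0) =
          trans (dot-pt-false-⁅⁆ (spike i W) k) (cong -_ (spike-∈ i W k≢i (Equivalence.from (∈W⇔ k) ak<0)))
          where
          k≢i : k ≢ i
          k≢i refl = ℚ.<-asym 0<ai ak<0
    choose (no no-pos) = inj₂ tt , covered
      where
      covered : TightImplies a b (coeff (inj₂ tt)) 1ℚ
      covered (true , A) _ tight =
        ⊥-elim (dot-ρ-nonpos-≢ {c = a} {A} 0<b (λ k → ℚ.≮⇒≥ (λ 0<ak → no-pos (k , 0<ak))) tight)
      covered (false , B) anti tight = singleton (tight-Q anti tight)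
        where
        singleton : ∀ {B} → Σ (Fin d) (λ k → B ≡ ⁅ k ⁆ × a k ℚ.< 0ℚ) →
          dot (coeff (inj₂ tt)) (pt (false , B)) ≡ 1ℚ
        singleton (k , refl , _) = dot-pt-false-⁅⁆ (coeff (inj₂ tt)) k

  enum : Fin (d * 2 ^ n + 1) ↔ Index
  enum = ↔-trans (Fin.+↔⊎ {d * 2 ^ n} {1})
    (↔-trans (Fin.*↔× {d} {2 ^ n}) (↔-refl ×-↔ Fin2^↔Vec n) ⊎-↔ Fin.1↔⊤)

  numFacets-d2^n+1 : NumFacets P Q (d * 2 ^ n + 1)
  numFacets-d2^n+1 = numFacets enum coeff bounded determines injective covers

-- The bound 14·6^((d−3)/2)

-- (12/5)² < 6, so growing by a factor at most 12/5 per step keeps x below 14·6^((d−3)/2).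
BelowBound-step : ∀ x y m → BelowBound x m → 5 * y ≤ 12 * x → BelowBound y (ℕ.suc m)
BelowBound-step x y m below 5y≤12x = begin-strict
  216 * (y * y)           ≤⟨ ℕ.*-monoʳ-≤ 216 y²≤6x² ⟩
  216 * (6 * (x * x))     ≡⟨ solve 1 (λ x → con 216 :* (con 6 :* (x :* x)) := con 6 :* (con 216 :* (x :* x))) refl x ⟩
  6 * (216 * (x * x))     <⟨ ℕ.*-monoʳ-< 6 below ⟩
  6 * (196 * 6 ^ m)       ≡⟨ solve 1 (λ p → con 6 :* (con 196 :* p) := con 196 :* (con 6 :* p)) refl (6 ^ m) ⟩
  196 * 6 ^ ℕ.suc m       ∎
  where
  open ℕ.≤-Reasoning
  open +-*-Solver
  y²≤6x² : y * y ≤ 6 * (x * x)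
  y²≤6x² = ℕ.*-cancelˡ-≤ 25 (begin
    25 * (y * y)                        ≡⟨ solve 1 (λ y → con 25 :* (y :* y) := (con 5 :* y) :* (con 5 :* y)) refl y ⟩
    (5 * y) * (5 * y)                   ≤⟨ ℕ.*-mono-≤ 5y≤12x 5y≤12x ⟩
    (12 * x) * (12 * x)                 ≤⟨ ℕ.m≤m+n _ (6 * (x * x)) ⟩
    (12 * x) * (12 * x) + 6 * (x * x)   ≡⟨ solve 1 (λ x → (con 12 :* x) :* (con 12 :* x) :+ con 6 :* (x :* x)
                                                          := con 25 :* (con 6 :* (x :* x))) refl x ⟩
    25 * (6 * (x * x))                  ∎)

BelowBound-induction : ∀ (f : ℕ → ℕ) m → BelowBound (f 0) m → (∀ e → 5 * f (ℕ.suc e) ≤ 12 * f e) →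
  ∀ e → BelowBound (f e) (m + e)
BelowBound-induction f m base growth ℕ.zero = subst (BelowBound (f 0)) (sym (ℕ.+-identityʳ m)) base
BelowBound-induction f m base growth (ℕ.suc e) = subst (BelowBound (f (ℕ.suc e))) (sym (ℕ.+-suc m e))
  (BelowBound-step (f e) (f (ℕ.suc e)) (m + e) (BelowBound-induction f m base growth e) (growth e))

2^d-below : ∀ n → BelowBound (2 ^ ℕ.suc n) (ℕ.suc n)
2^d-below = BelowBound-induction (λ e → 2 ^ ℕ.suc e) 1 (ℕ.<ᵇ⇒< _ _ tt) growth
  where
  open +-*-Solver
  growth : ∀ e → 5 * 2 ^ ℕ.suc (ℕ.suc e) ≤ 12 * 2 ^ ℕ.suc e
  growth e = subst (_≤ 12 * 2 ^ ℕ.suc e) (solve 1 (λ p → con 10 :* p := con 5 :* (con 2 :* p)) refl (2 ^ ℕ.suc e))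
    (ℕ.*-monoˡ-≤ (2 ^ ℕ.suc e) (ℕ.≤ᵇ⇒≤ 10 12 tt))

d²+d-below : ∀ n → ¬ ℕ.suc n ≡ 2 → BelowBound (ℕ.suc n * ℕ.suc n + ℕ.suc n) (ℕ.suc n)
d²+d-below 0 _ = ℕ.<ᵇ⇒< _ _ tt
d²+d-below 1 2≢2 = ⊥-elim (2≢2 refl)
d²+d-below (ℕ.suc (ℕ.suc e)) _ = BelowBound-induction f 3 (ℕ.<ᵇ⇒< _ _ tt) growth e
  where
  open +-*-Solver
  f : ℕ → ℕ
  f e = (3 + e) * (3 + e) + (3 + e)
  growth : ∀ e → 5 * f (ℕ.suc e) ≤ 12 * f e
  growth e = subst (5 * f (ℕ.suc e) ≤_) (sym (solve 1 (λ e →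
      con 12 :* ((con 3 :+ e) :* (con 3 :+ e) :+ (con 3 :+ e)) :=
      con 5 :* ((con 4 :+ e) :* (con 4 :+ e) :+ (con 4 :+ e)) :+ (con 7 :* (e :* e) :+ con 39 :* e :+ con 44)) refl e))
    (ℕ.m≤m+n _ _)

d2^[d-1]+1-below : ∀ n → BelowBound (ℕ.suc n * 2 ^ n + 1) (ℕ.suc n)
d2^[d-1]+1-below 0 = ℕ.<ᵇ⇒< _ _ tt
d2^[d-1]+1-below 1 = ℕ.<ᵇ⇒< _ _ tt
d2^[d-1]+1-below 2 = ℕ.<ᵇ⇒< _ _ tt
d2^[d-1]+1-below 3 = ℕ.<ᵇ⇒< _ _ tt
d2^[d-1]+1-below (ℕ.suc (ℕ.suc (ℕ.suc (ℕ.suc e)))) = BelowBound-induction f 5 (ℕ.<ᵇ⇒< _ _ tt) growth e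
  where
  open +-*-Solver
  f : ℕ → ℕ
  f e = (5 + e) * 2 ^ (4 + e) + 1
  growth : ∀ e → 5 * f (ℕ.suc e) ≤ 12 * f e
  growth e = subst (5 * f (ℕ.suc e) ≤_) (sym (solve 2 (λ e p →
      con 12 :* ((con 5 :+ e) :* p :+ con 1) :=
      con 5 :* ((con 6 :+ e) :* (con 2 :* p) :+ con 1) :+ (con 2 :* e :* p :+ con 7)) refl e (2 ^ (4 + e))))
    (ℕ.m≤m+n _ _)

proposition2p5 : (d : ℕ) → 1 ≤ d →
    (P Q : Rel d) → IsPartialOrder _≡_ P → IsPartialOrder _≡_ Q →
    ((OrderIso P chainRel → OrderIso Q chainRel →
        NumFacets P Q (2 ^ d) × BelowBound (2 ^ d) d) ×
     (OrderIso P antichainRel → OrderIso Q antichainRel →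
        NumFacets P Q (d * d + d) ×
        (d ≡ 2 → d * d + d ≡ 6) × (¬ d ≡ 2 → BelowBound (d * d + d) d))) ×
    (OrderIso P antichainRel → OrderIso Q chainRel →
        NumFacets P Q (d * 2 ^ (d ∸ 1) + 1) × BelowBound (d * 2 ^ (d ∸ 1) + 1) d)
proposition2p5 (ℕ.suc n) _ P Q _ _ =
  ( (λ isoP isoQ → ChainChain.numFacets-2^d isoP isoQ , 2^d-below n)
  , (λ isoP isoQ → AntichainAntichain.numFacets-d²+d isoP isoQ , cong (λ d → d * d + d) , d²+d-below n))
  , (λ isoP isoQ → AntichainChain.numFacets-d2^n+1 isoP isoQ , d2^[d-1]+1-below n)
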